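{- Let $k\ge 3$ and $t\ge1$ be integers. For every $k$-admissible triple $(P,Q,R)$ and all sufficiently large $n$, $$t\,e(H_n(P,Q,R))+N(K_3,H_n(P,Q,R))=t\left\lfloor\frac{n^2}{4}\right\rfloor+f(k-1,k-1)n+\Phi(P,Q,R,t).$$ Consequently, for sufficiently large $n$, $g(k,t,n)\geq t\lfloor n^2/4\rfloor+f(k-1,k-1)n+c_k^*(t)$.
   Context: $N(K_3,H)$ is the number of triangles in $H$. The friendship graph $F_k$ consists of $k$ triangles sharing one common vertex. $g(k,t,n)=\max\{t\, e(H)+N(K_3,H): |V(H)|=n,\ H\text{ is }F_k\text{ -free}\}$. $\nu(G)$ is the matching number and $\Delta(G)$ the maximum degree. $f(\nu,\Delta)=\max\{e(G):\nu(G)\le\nu,\ \Delta(G)\le\Delta\}$. $\mathcal{P}_k$ is the family of all graphs $P$ without isolated vertices with $\nu(P)\le k-1$, $\Delta(P)\le k-1$ and $e(P)=f(k-1,k-1)$. For $P,Q\in\mathcal{P}_k$ with $A=V(P)$, $B=V(Q)$ (disjoint) and a bipartite graph $R$ with parts $A,B$, the triple $(P,Q,R)$ is $k$-admissible if $d_P(a)+\nu(Q[N_R(a)])\le k-1$ for every $a\in A$ and $d_Q(b)+\nu(P[N_R(b)])\le k-1$ for every $b\in B$. Given such a triple, $H_n(P,Q,R)$ is the $n$-vertex graph obtained as follows: take a balanced partition $X\cup Y$ of an $n$-vertex set ($||X|-|Y||\le1$), place a copy of $P$ on a subset $A\subseteq X$ and a copy of $Q$ on a subset $B\subseteq Y$,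 with no other edges inside $X$ or inside $Y$; the edges between $X$ and $Y$ are $\bigl((X\times Y)\setminus(A\times B)\bigr)\cup E(R)$. Define $\tau_R(P,Q)=\sum_{aa'\in E(P)}|N_R(a)\cap N_R(a')|+\sum_{bb'\in E(Q)}|N_R(b)\cap N_R(b')|$ and $\Phi(P,Q,R,t)=(2f(k-1,k-1)-|A||B|+e(R))t-f(k-1,k-1)(|A|+|B|)+N(K_3,P)+N(K_3,Q)+\tau_R(P,Q)$, and $c_k^*(t)=\max\{\Phi(P,Q,R,t):(P,Q,R)\text{ is }k\text{ -admissible}\}$. -}

module Defs where

open import Data.Nat using (ℕ; zero; suc; _+_; _*_; _∸_; _≤_; _<?_; _<ᵇ_)
open import Data.Nat.DivMod using (_/_)
open import Data.Bool using (Bool; true; false; if_then_else_; _∧_; not)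
open import Data.Fin using (Fin; zero; suc; toℕ; fromℕ<; _↑ˡ_; _↑ʳ_)
open import Data.Maybe using (Maybe; just; nothing)
open import Data.Product using (Σ; _×_; _,_; ∃)
open import Data.List using (List; []; _∷_; length; concatMap)
open import Data.List.Relation.Unary.All using (All)
open import Data.List.Relation.Unary.Unique.Propositional using (Unique)
open import Data.Integer using (ℤ; +_; _-_) renaming (_+_ to _+ℤ_; _*_ to _*ℤ_)
open import Relation.Nullary using (yes; no; ¬_)
open import Relation.Binary.PropositionalEquality using (_≡_)

-- A graph is given by raw data G : Fin n → Fin n → Bool of which only the
-- entries G i j with toℕ i < toℕ j are read; the (symmetric, loopless)
-- adjacency relation is E G.  Every simple graph on Fin n arises this way.

Graph : ℕ → Set
Graph n = Fin n → Fin n → Bool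

E : {n : ℕ} → Graph n → Fin n → Fin n → Bool
E G i j =
  if toℕ i <ᵇ toℕ j then G i j
  else (if toℕ j <ᵇ toℕ i then G j i else false)

sumF : {n : ℕ} → (Fin n → ℕ) → ℕ
sumF {zero}  f = 0
sumF {suc n} f = f zero + sumF (λ i → f (suc i))

countF : {n : ℕ} → (Fin n → Bool) → ℕ
countF p = sumF (λ i → if p i then 1 else 0)

_<F_ : {n : ℕ} → Fin n → Fin n → Bool
i <F j = toℕ i <ᵇ toℕ j

deg : {n : ℕ} → Graph n → Fin n → ℕ
deg G v = countF (λ j → E G v j)

edges : {n : ℕ} → Graph n → ℕ
edges G = sumF (λ i → countF (λ j → (i <F j) ∧ E G i j))

triangles : {n : ℕ} → Graph n → ℕ
triangles G = sumF (λ i → sumF (λ j → countF (λ l →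
  (i <F j) ∧ (j <F l) ∧ E G i j ∧ E G j l ∧ E G i l)))

NoIsolated : {n : ℕ} → Graph n → Set
NoIsolated G = ∀ v → ∃ (λ u → E G v u ≡ true)

MaxDegLE : {n : ℕ} → Graph n → ℕ → Set
MaxDegLE G d = ∀ v → deg G v ≤ d

endpoints : {n : ℕ} → List (Fin n × Fin n) → List (Fin n)
endpoints = concatMap (λ { (u , v) → u ∷ v ∷ [] })

IsMatchingIn : {n : ℕ} → Graph n → (Fin n → Bool) → List (Fin n × Fin n) → Set
IsMatchingIn G S M =
  All (λ { (u , v) → (E G u v ≡ true) × (S u ≡ true) × (S v ≡ true) }) M
  × Unique (endpoints M)

MatchLE : {n : ℕ} → Graph n → (Fin n → Bool) → ℕ → Set
MatchLE G S m = ∀ M → IsMatchingIn G S M → length M ≤ m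

allV : {n : ℕ} → Fin n → Bool
allV _ = true

-- fv = f(ν,Δ) = max{ e(G) : ν(G) ≤ ν, Δ(G) ≤ Δ }  (maximum over all finite graphs)
IsF : ℕ → ℕ → ℕ → Set
IsF ν Δ fv =
  Σ ℕ (λ n → Σ (Graph n) (λ G → MatchLE G allV ν × MaxDegLE G Δ × edges G ≡ fv))
  × (∀ (n : ℕ) (G : Graph n) → MatchLE G allV ν → MaxDegLE G Δ → edges G ≤ fv)

InPk : ℕ → ℕ → {a : ℕ} → Graph a → Set
InPk k fv P =
  NoIsolated P × MatchLE P allV (k ∸ 1) × MaxDegLE P (k ∸ 1) × edges P ≡ fv

BipGraph : ℕ → ℕ → Set
BipGraph a b = Fin a → Fin b → Bool

transposeB : {a b : ℕ} → BipGraph a b → BipGraph b a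
transposeB R y x = R x y

Admissible : ℕ → ℕ → {a b : ℕ} → Graph a → Graph b → BipGraph a b → Set
Admissible k fv {a} {b} P Q R =
  InPk k fv P × InPk k fv Q
  × (∀ (x : Fin a) M → IsMatchingIn Q (R x) M → deg P x + length M ≤ k ∸ 1)
  × (∀ (y : Fin b) M → IsMatchingIn P (transposeB R y) M → deg Q y + length M ≤ k ∸ 1)

eR : {a b : ℕ} → BipGraph a b → ℕ
eR R = sumF (λ x → countF (λ y → R x y))

tauPart : {a b : ℕ} → Graph a → BipGraph a b → ℕ
tauPart P R = sumF (λ i → sumF (λ j →
  if (i <F j) ∧ E P i j then countF (λ y → R i y ∧ R j y) else 0))

tau : {a b : ℕ} → Graph a → Graph b → BipGraph a b → ℕ
tau P Q R = tauPart P R + tauPart Q (transposeB R)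

Φ : ℕ → {a b : ℕ} → Graph a → Graph b → BipGraph a b → ℕ → ℤ
Φ fv {a} {b} P Q R t =
  ((+ (2 * fv) - + (a * b)) +ℤ + eR R) *ℤ + t
  - + (fv * (a + b))
  +ℤ + triangles P +ℤ + triangles Q +ℤ + tau P Q R

IsCStar : ℕ → ℕ → ℕ → ℤ → Set
IsCStar k fv t c =
  Σ ℕ (λ a → Σ ℕ (λ b → Σ (Graph a) (λ P → Σ (Graph b) (λ Q → Σ (BipGraph a b) (λ R →
     Admissible k fv P Q R × Φ fv P Q R t ≡ c)))))
  × (∀ (a b : ℕ) (P : Graph a) (Q : Graph b) (R : BipGraph a b) →
       Admissible k fv P Q R → Φ fv P Q R t Data.Integer.≤ c)

-- H_n(P,Q,R) on vertex set Fin n: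
-- X = {0,…,⌊n/2⌋-1}, Y = {⌊n/2⌋,…,n-1};  A = {0,…,a-1} ⊆ X,
-- B = {⌊n/2⌋,…,⌊n/2⌋+b-1} ⊆ Y (for n large enough that a ≤ ⌊n/2⌋, b ≤ ⌈n/2⌉).

toFin? : (a m : ℕ) → Maybe (Fin a)
toFin? a m with m <? a
... | yes p = just (fromℕ< p)
... | no _  = nothing

inside : {a : ℕ} → Graph a → ℕ → ℕ → Bool
inside {a} P u v with toFin? a u | toFin? a v
... | just x | just y = E P x y
... | _      | _      = false

cross : {a b : ℕ} → BipGraph a b → ℕ → ℕ → Bool
cross {a} {b} R u w with toFin? a u | toFin? b w
... | just x | just y = R x y
... | _      | _      = true

Hadj : (n : ℕ) → {a b : ℕ} → Graph a → Graph b → BipGraph a b → ℕ → ℕ → Bool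
Hadj n P Q R u v with u <ᵇ (n / 2) | v <ᵇ (n / 2)
... | true  | true  = inside P u v
... | false | false = inside Q (u ∸ (n / 2)) (v ∸ (n / 2))
... | true  | false = cross R u (v ∸ (n / 2))
... | false | true  = cross R v (u ∸ (n / 2))

H : (n : ℕ) → {a b : ℕ} → Graph a → Graph b → BipGraph a b → Graph n
H n P Q R i j = Hadj n P Q R (toℕ i) (toℕ j)

-- F_k-free: no injective φ : Fin (1+k+k) → Fin n with φ 0 the centre and
-- triangles φ0, φ(x_i), φ(y_i) for all i < k (a (not nec. induced) copy of F_k)

FkCopy : (k : ℕ) {n : ℕ} → Graph n → (Fin (suc (k + k)) → Fin n) → Set
FkCopy k G φ =
  (∀ i j → φ i ≡ φ j → i ≡ j)
  × (∀ (i : Fin k) →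
       (E G (φ zero) (φ (suc (i ↑ˡ k))) ≡ true)
       × (E G (φ zero) (φ (suc (k ↑ʳ i))) ≡ true)
       × (E G (φ (suc (i ↑ˡ k))) (φ (suc (k ↑ʳ i))) ≡ true))

FkFree : (k : ℕ) {n : ℕ} → Graph n → Set
FkFree k G = ∀ φ → ¬ FkCopy k G φ

value : ℕ → {n : ℕ} → Graph n → ℕ
value t G = t * edges G + triangles G

-- Write X = [0, ⌊n/2⌋) and Y = [⌊n/2⌋, n) for the two halves of H = H_n(P,Q,R).
--
-- The vertices of a triangle u < v < w of H that lie in X form an initial segment of u, v, w,
-- so the triangle has shape XXX, XXY, XYY or YYY. Those of shape XXX and YYY are the triangles of P and
-- Q; one of shape XXY is an edge aa′ of P with a common neighbour in Y, of which there are
-- |N_R(a) ∩ N_R(a′)| + |Y ∖ B|, and symmetrically for XYY. So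
--   N(K₃,H) = N(K₃,P) + N(K₃,Q) + τ_R(P,Q) + e(P)|Y ∖ B| + e(Q)|X ∖ A|,
--   e(H)    = e(P) + e(Q) + e(R) + |X||Y| − |A||B|,
-- and with e(P) = e(Q) = f(k−1,k−1) and |X||Y| = ⌊n²/4⌋ this is the identity, once A and B fit into X
-- and Y, e.g. for n ≥ 2(|A| + |B|).
--
-- The k petals of a copy of F_k centred at c are k disjoint edges in the link of c. For
-- c ∈ X, a petal with a vertex in X uses a P-neighbour of c and the other petals form a matching of Q
-- inside N_R(c) (of Q itself if c ∉ A), so admissibility gives k ≤ d_P(c) + ν(Q[N_R(c)]) ≤ k − 1
-- (resp. k ≤ ν(Q) ≤ k − 1). Centres in Y are symmetric.

module Submission where

open import Defs
open import Algebra.Properties.CommutativeSemigroup using (interchange)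
open import Data.Bool using (Bool; true; false; if_then_else_; _∧_)
open import Data.Bool.Properties using (∧-comm; ∧-zeroʳ)
open import Data.Empty using (⊥; ⊥-elim)
open import Data.Fin using (Fin; zero; suc; toℕ; fromℕ<; _↑ˡ_; _↑ʳ_; splitAt)
open import Data.Fin.Properties
  using ( toℕ<n; fromℕ<-toℕ; toℕ-fromℕ<; toℕ-injective; ↑ˡ-injective; ↑ʳ-injective
        ; splitAt-↑ˡ; splitAt-↑ʳ)
import Data.Fin.Properties as Fin
open import Data.List using (List; []; _∷_; length)
open import Data.List.Relation.Unary.All as All using (All; []; _∷_)
open import Data.List.Relation.Unary.AllPairs using ([]; _∷_)
open import Data.List.Relation.Unary.Unique.Propositional using (Unique)
open import Data.Maybe using (just; nothing)
open import Data.Nat using (ℕ; zero; suc; _+_; _*_; _∸_; _≤_; _<_; _<ᵇ_; _<?_; z≤n; s≤s; z<s; s<s; s≤s⁻¹)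
open import Data.Nat.DivMod
  using (_/_; _%_; m≡m%n+[m/n]*n; m%n<n; m*n/n≡m; m<n⇒m/n≡0; m/n≤m; +-distrib-/-∣ˡ; /-monoˡ-≤; m/n*n≤m)
open import Data.Nat.Divisibility using (n∣m*n)
open import Data.Nat.Properties
import Data.Nat.Tactic.RingSolver as ℕ-Solver
open import Data.Product using (Σ; ∃; ∃₂; _×_; _,_; proj₁; proj₂)
open import Data.Sum using (_⊎_; inj₁; inj₂)
open import Function using (flip)
open import Relation.Nullary using (Dec; yes; no)
open import Relation.Binary.PropositionalEquality

-- Sums over initial segments of ℕ

𝟙 : Bool → ℕ
𝟙 b = if b then 1 else 0

∑< : ℕ → (ℕ → ℕ) → ℕ
∑< zero    f = 0
∑< (suc n) f = f 0 + ∑< n (λ i → f (suc i))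

sumF≡∑< : ∀ n (f : ℕ → ℕ) → sumF {n} (λ i → f (toℕ i)) ≡ ∑< n f
sumF≡∑< zero    f = refl
sumF≡∑< (suc n) f = cong (f 0 +_) (sumF≡∑< n (λ i → f (suc i)))

sumF-cong : ∀ {n} {f g : Fin n → ℕ} → (∀ i → f i ≡ g i) → sumF f ≡ sumF g
sumF-cong {zero}  f≗g = refl
sumF-cong {suc n} f≗g = cong₂ _+_ (f≗g zero) (sumF-cong (λ i → f≗g (suc i)))

sumF²≡∑<² : ∀ a b (f : ℕ → ℕ → ℕ) →
  sumF {a} (λ i → sumF {b} (λ j → f (toℕ i) (toℕ j))) ≡ ∑< a (λ u → ∑< b (f u))
sumF²≡∑<² a b f =
  trans (sumF-cong {a} (λ i → sumF≡∑< b (f (toℕ i)))) (sumF≡∑< a (λ u → ∑< b (f u)))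

∑<-cong : ∀ n {f g : ℕ → ℕ} → (∀ i → i < n → f i ≡ g i) → ∑< n f ≡ ∑< n g
∑<-cong zero    f≗g = refl
∑<-cong (suc n) f≗g = cong₂ _+_ (f≗g 0 z<s) (∑<-cong n (λ i i<n → f≗g (suc i) (s<s i<n)))

∑<-+ : ∀ m r (f : ℕ → ℕ) → ∑< (m + r) f ≡ ∑< m f + ∑< r (λ i → f (m + i))
∑<-+ zero    r f = refl
∑<-+ (suc m) r f = trans (cong (f 0 +_) (∑<-+ m r (λ i → f (suc i)))) (sym (+-assoc (f 0) _ _))

∑<-split : ∀ {m n} (f : ℕ → ℕ) → m ≤ n → ∑< n f ≡ ∑< m f + ∑< (n ∸ m) (λ i → f (m + i))
∑<-split {m} {n} f m≤n = trans (cong (λ z → ∑< z f) (sym (m+[n∸m]≡n m≤n))) (∑<-+ m (n ∸ m) f)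

∑<-const : ∀ n c → ∑< n (λ _ → c) ≡ n * c
∑<-const zero    c = refl
∑<-const (suc n) c = cong (c +_) (∑<-const n c)

∑<-zero : ∀ n {f : ℕ → ℕ} → (∀ i → i < n → f i ≡ 0) → ∑< n f ≡ 0
∑<-zero n f≗0 = trans (∑<-cong n f≗0) (trans (∑<-const n 0) (*-zeroʳ n))

∑<-distrib-+ : ∀ n (f g : ℕ → ℕ) → ∑< n (λ i → f i + g i) ≡ ∑< n f + ∑< n g
∑<-distrib-+ zero    f g = refl
∑<-distrib-+ (suc n) f g =
  trans (cong (f 0 + g 0 +_) (∑<-distrib-+ n _ _)) (interchange +-commutativeSemigroup (f 0) (g 0) _ _)

∑<-distribʳ-* : ∀ n c (f : ℕ → ℕ) → ∑< n (λ i → f i * c) ≡ ∑< n f * c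
∑<-distribʳ-* zero    c f = refl
∑<-distribʳ-* (suc n) c f =
  trans (cong (f 0 * c +_) (∑<-distribʳ-* n c _)) (sym (*-distribʳ-+ c (f 0) _))

∑<-comm : ∀ m r (f : ℕ → ℕ → ℕ) →
  ∑< m (λ i → ∑< r (λ j → f i j)) ≡ ∑< r (λ j → ∑< m (λ i → f i j))
∑<-comm zero    r f = sym (∑<-zero r (λ _ _ → refl))
∑<-comm (suc m) r f =
  trans (cong (∑< r (f 0) +_) (∑<-comm m r (λ i → f (suc i))))
        (sym (∑<-distrib-+ r (f 0) (λ j → ∑< m (λ i → f (suc i) j))))

∑<-if : ∀ n c (f : ℕ → ℕ) → ∑< n (λ i → if c then f i else 0) ≡ (if c then ∑< n f else 0)
∑<-if n true  f = refl
∑<-if n false f = ∑<-zero n (λ _ _ → refl)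

𝟙[c∧x∧y∧z]≡if[c∧x]𝟙[z∧y] : ∀ c x y z →
  𝟙 (c ∧ x ∧ y ∧ z) ≡ (if c ∧ x then 𝟙 (z ∧ y) else 0)
𝟙[c∧x∧y∧z]≡if[c∧x]𝟙[z∧y] true  true  y z = cong 𝟙 (∧-comm y z)
𝟙[c∧x∧y∧z]≡if[c∧x]𝟙[z∧y] true  false y z = refl
𝟙[c∧x∧y∧z]≡if[c∧x]𝟙[z∧y] false x     y z = refl

𝟙[c∧x∧d∧y]≡if[c∧d]𝟙[x∧y] : ∀ c x d y →
  𝟙 (c ∧ x ∧ d ∧ y) ≡ (if c ∧ d then 𝟙 (x ∧ y) else 0)
𝟙[c∧x∧d∧y]≡if[c∧d]𝟙[x∧y] true  true  true  y = refl
𝟙[c∧x∧d∧y]≡if[c∧d]𝟙[x∧y] true  false true  y = refl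
𝟙[c∧x∧d∧y]≡if[c∧d]𝟙[x∧y] true  true  false y = refl
𝟙[c∧x∧d∧y]≡if[c∧d]𝟙[x∧y] true  false false y = refl
𝟙[c∧x∧d∧y]≡if[c∧d]𝟙[x∧y] false x     d     y = refl

∑<-restrict : ∀ {a n} (f : ℕ → ℕ) → a ≤ n → (∀ i → a ≤ i → f i ≡ 0) → ∑< n f ≡ ∑< a f
∑<-restrict {a} {n} f a≤n f≗0 = begin
  ∑< n f                                ≡⟨ ∑<-split f a≤n ⟩
  ∑< a f + ∑< (n ∸ a) (λ i → f (a + i)) ≡⟨ cong (∑< a f +_) tail≡0 ⟩
  ∑< a f + 0                            ≡⟨ +-identityʳ _ ⟩
  ∑< a f                                ∎
  where
  open ≡-Reasoning
  tail≡0 : ∑< (n ∸ a) (λ i → f (a + i)) ≡ 0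
  tail≡0 = ∑<-zero (n ∸ a) λ i _ → f≗0 (a + i) (m≤m+n a i)

countF-cong : ∀ {n} {p q : Fin n → Bool} → (∀ i → p i ≡ q i) → countF p ≡ countF q
countF-cong p≗q = sumF-cong (λ i → cong 𝟙 (p≗q i))

countF-false : ∀ {n} {p : Fin n → Bool} → (∀ i → p i ≡ false) → countF p ≡ 0
countF-false {n} p≗false =
  trans (countF-cong p≗false) (trans (sumF≡∑< n (λ _ → 0)) (∑<-zero n (λ _ _ → refl)))

-- Graphs on Fin n and their adjacency on ℕ labels

<⇒<ᵇ≡true : ∀ {u v} → u < v → (u <ᵇ v) ≡ true
<⇒<ᵇ≡true {zero}  {suc v} z<s       = refl
<⇒<ᵇ≡true {suc u} {suc v} (s<s u<v) = <⇒<ᵇ≡true u<v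

≤⇒<ᵇ≡false : ∀ {u v} → v ≤ u → (u <ᵇ v) ≡ false
≤⇒<ᵇ≡false {u}     {zero}  z≤n       = refl
≤⇒<ᵇ≡false {suc u} {suc v} (s≤s v≤u) = ≤⇒<ᵇ≡false v≤u

<ᵇ≡true⇒< : ∀ u v → (u <ᵇ v) ≡ true → u < v
<ᵇ≡true⇒< zero    (suc v) _ = z<s
<ᵇ≡true⇒< (suc u) (suc v) e = s<s (<ᵇ≡true⇒< u v e)

+-<ᵇ : ∀ m {i j} → (m + i <ᵇ m + j) ≡ (i <ᵇ j)
+-<ᵇ zero    = refl
+-<ᵇ (suc m) = +-<ᵇ m

∧-congˡ-true : ∀ c {x y} → (c ≡ true → x ≡ y) → (c ∧ x) ≡ (c ∧ y)
∧-congˡ-true true  x≡y = x≡y refl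
∧-congˡ-true false _   = refl

E-above-diagonal : ∀ {n} (G : Graph n) i j → (toℕ i <ᵇ toℕ j) ≡ true → E G i j ≡ G i j
E-above-diagonal G i j i<j rewrite i<j = refl

E-sym : ∀ {n} (G : Graph n) i j → E G i j ≡ E G j i
E-sym G i j with toℕ i <ᵇ toℕ j in i<j | toℕ j <ᵇ toℕ i in j<i
... | true  | true  = ⊥-elim (<-asym (<ᵇ≡true⇒< (toℕ i) (toℕ j) i<j)
                                     (<ᵇ≡true⇒< (toℕ j) (toℕ i) j<i))
... | true  | false = refl
... | false | true  = refl
... | false | false = refl

E≡true⇒raw≡true : ∀ {n} (G : Graph n) → (∀ i j → G i j ≡ G j i) →
  ∀ i j → E G i j ≡ true → G i j ≡ true
E≡true⇒raw≡true G G-sym i j e with toℕ i <ᵇ toℕ j | toℕ j <ᵇ toℕ i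
... | true  | _     = e
... | false | true  = trans (G-sym i j) e

IsMatchingIn-mono : ∀ {n} {G : Graph n} {S S′ : Fin n → Bool} → (∀ v → S v ≡ true → S′ v ≡ true) →
  ∀ {M} → IsMatchingIn G S M → IsMatchingIn G S′ M
IsMatchingIn-mono S⊆S′ (in-S , unique) =
  All.map (λ { {u , v} (Euv , Su , Sv) → Euv , S⊆S′ u Su , S⊆S′ v Sv }) in-S , unique

private
  dropZero : ∀ {n} → List (Fin (suc n)) → List (Fin n)
  dropZero []           = []
  dropZero (zero  ∷ xs) = dropZero xs
  dropZero (suc x ∷ xs) = x ∷ dropZero xs

  dropZero-All : ∀ {n} {P : Fin (suc n) → Set} {xs} → All P xs → All (λ x → P (suc x)) (dropZero xs)
  dropZero-All {xs = []}         []       = []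
  dropZero-All {xs = zero  ∷ xs} (_ ∷ ps) = dropZero-All ps
  dropZero-All {xs = suc x ∷ xs} (p ∷ ps) = p ∷ dropZero-All ps

  dropZero-Unique : ∀ {n} {xs : List (Fin (suc n))} → Unique xs → Unique (dropZero xs)
  dropZero-Unique {xs = []}         []       = []
  dropZero-Unique {xs = zero  ∷ xs} (_ ∷ u)  = dropZero-Unique u
  dropZero-Unique {xs = suc x ∷ xs} (x∉ ∷ u) =
    All.map (λ x≢y x≡y → x≢y (cong suc x≡y)) (dropZero-All x∉) ∷ dropZero-Unique u

  length-dropZero : ∀ {n} (xs : List (Fin (suc n))) → All (zero ≢_) xs → length xs ≤ length (dropZero xs)
  length-dropZero []           []        = z≤n
  length-dropZero (zero  ∷ xs) (0≢0 ∷ _) = ⊥-elim (0≢0 refl)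
  length-dropZero (suc x ∷ xs) (_ ∷ 0∉)  = s≤s (length-dropZero xs 0∉)

  length≤𝟙+length-dropZero : ∀ {n} (p : Fin (suc n) → Bool) xs → Unique xs → All (λ x → p x ≡ true) xs →
    length xs ≤ 𝟙 (p zero) + length (dropZero xs)
  length≤𝟙+length-dropZero p []           _        _          = z≤n
  length≤𝟙+length-dropZero p (zero  ∷ xs) (0∉ ∷ _) (p0 ∷ _) rewrite p0 = s≤s (length-dropZero xs 0∉)
  length≤𝟙+length-dropZero p (suc x ∷ xs) (_ ∷ u)  (_ ∷ ps)  =
    subst (suc (length xs) ≤_) (sym (+-suc (𝟙 (p zero)) _)) (s≤s (length≤𝟙+length-dropZero p xs u ps))

unique-length≤countF : ∀ {n} (p : Fin n → Bool) xs → Unique xs → All (λ x → p x ≡ true) xs →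
  length xs ≤ countF p
unique-length≤countF {zero}  p []       _ _  = z≤n
unique-length≤countF {suc n} p xs u ps =
  ≤-trans (length≤𝟙+length-dropZero p xs u ps)
          (+-monoʳ-≤ (𝟙 (p zero))
            (unique-length≤countF (λ i → p (suc i)) (dropZero xs) (dropZero-Unique u) (dropZero-All ps)))

toFin?-toℕ : ∀ {a} (i : Fin a) → toFin? a (toℕ i) ≡ just i
toFin?-toℕ {a} i with toℕ i <? a
... | yes i<a = cong just (fromℕ<-toℕ i i<a)
... | no  i≮a = ⊥-elim (i≮a (toℕ<n i))

toFin?-just : ∀ a u {x} → toFin? a u ≡ just x → toℕ x ≡ u
toFin?-just a u e with u <? a
toFin?-just a u refl | yes u<a = toℕ-fromℕ< u<a

toFin?-≥ : ∀ a u → a ≤ u → toFin? a u ≡ nothing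
toFin?-≥ a u a≤u with u <? a
... | yes u<a = ⊥-elim (<⇒≱ u<a a≤u)
... | no  _   = refl

inside-toℕ : ∀ {a} (P : Graph a) (i j : Fin a) → inside P (toℕ i) (toℕ j) ≡ E P i j
inside-toℕ P i j rewrite toFin?-toℕ i | toFin?-toℕ j = refl

cross-toℕ : ∀ {a b} (R : BipGraph a b) (i : Fin a) (j : Fin b) → cross R (toℕ i) (toℕ j) ≡ R i j
cross-toℕ R i j rewrite toFin?-toℕ i | toFin?-toℕ j = refl

inside≡true⇒E : ∀ {a} (P : Graph a) u v → inside P u v ≡ true →
  ∃₂ λ x y → toℕ x ≡ u × toℕ y ≡ v × E P x y ≡ true
inside≡true⇒E {a} P u v e with toFin? a u in eu | toFin? a v in ev
... | just x | just y = x , y , toFin?-just a u eu , toFin?-just a v ev , e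

inside-sym : ∀ {a} (P : Graph a) u v → inside P u v ≡ inside P v u
inside-sym {a} P u v with toFin? a u | toFin? a v
... | just x  | just y  = E-sym P x y
... | just _  | nothing = refl
... | nothing | just _  = refl
... | nothing | nothing = refl

cross-transpose : ∀ {a b} (R : BipGraph a b) w u → cross (transposeB R) w u ≡ cross R u w
cross-transpose {a} {b} R w u with toFin? b w | toFin? a u
... | just _  | just _  = refl
... | just _  | nothing = refl
... | nothing | just _  = refl
... | nothing | nothing = refl

Supported< : ℕ → (ℕ → ℕ → Bool) → Set
Supported< a g = ∀ u v → a ≤ u ⊎ a ≤ v → g u v ≡ false

inside-supported : ∀ {a} (P : Graph a) → Supported< a (inside P)
inside-supported {a} P u v (inj₁ a≤u) rewrite toFin?-≥ a u a≤u = refl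
inside-supported {a} P u v (inj₂ a≤v) with toFin? a u
... | just _  rewrite toFin?-≥ a v a≤v = refl
... | nothing = refl

cross-outside : ∀ {a b} (R : BipGraph a b) u l → a ≤ u ⊎ b ≤ l → cross R u l ≡ true
cross-outside {a} {b} R u l (inj₁ a≤u) rewrite toFin?-≥ a u a≤u = refl
cross-outside {a} {b} R u l (inj₂ b≤l) with toFin? a u
... | just _  rewrite toFin?-≥ b l b≤l = refl
... | nothing = refl

-- Edge and triangle counts over initial segments of ℕ

edges< : ℕ → (ℕ → ℕ → Bool) → ℕ
edges< n g = ∑< n λ u → ∑< n λ v → 𝟙 ((u <ᵇ v) ∧ g u v)

triangles< : ℕ → (ℕ → ℕ → Bool) → ℕ
triangles< n g = ∑< n λ u → ∑< n λ v → ∑< n λ w →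
  𝟙 ((u <ᵇ v) ∧ (v <ᵇ w) ∧ g u v ∧ g v w ∧ g u w)

codegree< : ℕ → (ℕ → ℕ → Bool) → ℕ → ℕ → ℕ
codegree< r c u v = ∑< r λ l → 𝟙 (c u l ∧ c v l)

tau< : ℕ → ℕ → (ℕ → ℕ → Bool) → (ℕ → ℕ → Bool) → ℕ
tau< a r g c = ∑< a λ u → ∑< a λ v → if (u <ᵇ v) ∧ g u v then codegree< r c u v else 0

module _ {n : ℕ} (G : Graph n) (g : ℕ → ℕ → Bool)
         (E≡g : ∀ i j → (toℕ i <ᵇ toℕ j) ≡ true → E G i j ≡ g (toℕ i) (toℕ j)) where

  edges≡edges< : edges G ≡ edges< n g
  edges≡edges< = trans (sumF-cong λ i → sumF-cong λ j → cong 𝟙 (∧-congˡ-true _ (E≡g i j)))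
                       (sumF²≡∑<² n n λ u v → 𝟙 ((u <ᵇ v) ∧ g u v))

  triangles≡triangles< : triangles G ≡ triangles< n g
  triangles≡triangles< =
    trans (sumF-cong λ i → sumF-cong λ j → trans (sumF-cong λ l → cong 𝟙 (same i j l))
                                                 (sumF≡∑< n (T (toℕ i) (toℕ j))))
          (sumF²≡∑<² n n λ u v → ∑< n (T u v))
    where
    T : ℕ → ℕ → ℕ → ℕ
    T u v w = 𝟙 ((u <ᵇ v) ∧ (v <ᵇ w) ∧ g u v ∧ g v w ∧ g u w)
    same : ∀ i j l → ((i <F j) ∧ (j <F l) ∧ E G i j ∧ E G j l ∧ E G i l)
                   ≡ ((toℕ i <ᵇ toℕ j) ∧ (toℕ j <ᵇ toℕ l)
                      ∧ g (toℕ i) (toℕ j) ∧ g (toℕ j) (toℕ l) ∧ g (toℕ i) (toℕ l))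
    same i j l = ∧-congˡ-true _ λ i<j → ∧-congˡ-true _ λ j<l →
      cong₂ _∧_ (E≡g i j i<j) (cong₂ _∧_ (E≡g j l j<l)
        (E≡g i l (<⇒<ᵇ≡true (<-trans (<ᵇ≡true⇒< (toℕ i) (toℕ j) i<j)
                                     (<ᵇ≡true⇒< (toℕ j) (toℕ l) j<l)))))

E≡inside : ∀ {a} (P : Graph a) i j → (toℕ i <ᵇ toℕ j) ≡ true → E P i j ≡ inside P (toℕ i) (toℕ j)
E≡inside P i j _ = sym (inside-toℕ P i j)

tauPart≡tau< : ∀ {a b} (P : Graph a) (R : BipGraph a b) (c : ℕ → ℕ → Bool) →
  (∀ i y → c (toℕ i) (toℕ y) ≡ R i y) → tauPart P R ≡ tau< a b (inside P) c
tauPart≡tau< {a} {b} P R c c≡R =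
  trans (sumF-cong λ i → sumF-cong λ j → same i j)
        (sumF²≡∑<² a a λ u v → if (u <ᵇ v) ∧ inside P u v then codegree< b c u v else 0)
  where
  same : ∀ i j → (if (i <F j) ∧ E P i j then countF (λ y → R i y ∧ R j y) else 0)
               ≡ (if (toℕ i <ᵇ toℕ j) ∧ inside P (toℕ i) (toℕ j)
                  then codegree< b c (toℕ i) (toℕ j) else 0)
  same i j rewrite inside-toℕ P i j with (i <F j) ∧ E P i j
  ... | false = refl
  ... | true  = trans (sumF-cong λ y → cong₂ (λ p q → 𝟙 (p ∧ q)) (sym (c≡R i y)) (sym (c≡R j y)))
                      (sumF≡∑< b λ l → 𝟙 (c (toℕ i) l ∧ c (toℕ j) l))

eR≡∑<² : ∀ {a b} (R : BipGraph a b) → eR R ≡ ∑< a (λ u → ∑< b (λ l → 𝟙 (cross R u l)))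
eR≡∑<² {a} {b} R = trans (sumF-cong λ i → sumF-cong λ j → cong 𝟙 (sym (cross-toℕ R i j)))
                         (sumF²≡∑<² a b λ u l → 𝟙 (cross R u l))

module _ {g g′ : ℕ → ℕ → Bool} where

  edges<-cong : ∀ n → (∀ u v → u < n → v < n → g u v ≡ g′ u v) → edges< n g ≡ edges< n g′
  edges<-cong n g≗g′ = ∑<-cong n λ u u<n → ∑<-cong n λ v v<n →
    cong (λ x → 𝟙 ((u <ᵇ v) ∧ x)) (g≗g′ u v u<n v<n)

  triangles<-cong : ∀ n → (∀ u v → u < n → v < n → g u v ≡ g′ u v) → triangles< n g ≡ triangles< n g′
  triangles<-cong n g≗g′ = ∑<-cong n λ u u<n → ∑<-cong n λ v v<n → ∑<-cong n λ w w<n →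
    cong₂ (λ x yz → 𝟙 ((u <ᵇ v) ∧ (v <ᵇ w) ∧ x ∧ yz))
          (g≗g′ u v u<n v<n) (cong₂ _∧_ (g≗g′ v w v<n w<n) (g≗g′ u w u<n w<n))

  tau<-cong : ∀ a r {c c′ : ℕ → ℕ → Bool} → (∀ u v → u < a → v < a → g u v ≡ g′ u v) →
    (∀ u l → u < a → l < r → c u l ≡ c′ u l) → tau< a r g c ≡ tau< a r g′ c′
  tau<-cong a r g≗g′ c≗c′ = ∑<-cong a λ u u<a → ∑<-cong a λ v v<a →
    cong₂ (λ x y → if (u <ᵇ v) ∧ x then y else 0) (g≗g′ u v u<a v<a)
          (∑<-cong r λ l l<r → cong₂ (λ x y → 𝟙 (x ∧ y)) (c≗c′ u l u<a l<r) (c≗c′ v l v<a l<r))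

∑<²-restrict : ∀ {a m} (F : ℕ → ℕ → ℕ) → a ≤ m → (∀ u v → a ≤ u ⊎ a ≤ v → F u v ≡ 0) →
  ∑< m (λ u → ∑< m (F u)) ≡ ∑< a (λ u → ∑< a (F u))
∑<²-restrict {a} {m} F a≤m F≗0 =
  trans (∑<-restrict _ a≤m λ u a≤u → ∑<-zero m λ v _ → F≗0 u v (inj₁ a≤u))
        (∑<-cong a λ u _ → ∑<-restrict (F u) a≤m λ v a≤v → F≗0 u v (inj₂ a≤v))

∑<-ones-beyond : ∀ {b r} (f : ℕ → ℕ) → b ≤ r → (∀ l → b ≤ l → f l ≡ 1) →
  ∑< r f ≡ ∑< b f + (r ∸ b)
∑<-ones-beyond {b} {r} f b≤r f≗1 = trans (∑<-split f b≤r) (cong (∑< b f +_)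
  (trans (∑<-cong (r ∸ b) λ i _ → f≗1 (b + i) (m≤m+n b i)) (trans (∑<-const (r ∸ b) 1) (*-identityʳ _))))

module _ {a m : ℕ} (g : ℕ → ℕ → Bool) (a≤m : a ≤ m) (g-supp : Supported< a g) where

  edges<-restrict : edges< m g ≡ edges< a g
  edges<-restrict = ∑<²-restrict _ a≤m λ u v out →
    cong 𝟙 (trans (cong ((u <ᵇ v) ∧_) (g-supp u v out)) (∧-zeroʳ (u <ᵇ v)))

  triangles<-restrict : triangles< m g ≡ triangles< a g
  triangles<-restrict =
    trans (∑<²-restrict _ a≤m λ u v out → ∑<-zero m λ w _ → cong 𝟙
             (trans (cong (λ x → (u <ᵇ v) ∧ (v <ᵇ w) ∧ x ∧ g v w ∧ g u w) (g-supp u v out))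
                    (trans (cong ((u <ᵇ v) ∧_) (∧-zeroʳ (v <ᵇ w))) (∧-zeroʳ (u <ᵇ v)))))
          (∑<-cong a λ u _ → ∑<-cong a λ v _ → ∑<-restrict _ a≤m λ w a≤w → cong 𝟙
             (trans (cong (λ x → (u <ᵇ v) ∧ (v <ᵇ w) ∧ g u v ∧ x ∧ g u w) (g-supp v w (inj₂ a≤w)))
                    (trans (cong (λ x → (u <ᵇ v) ∧ (v <ᵇ w) ∧ x) (∧-zeroʳ (g u v)))
                           (trans (cong ((u <ᵇ v) ∧_) (∧-zeroʳ (v <ᵇ w))) (∧-zeroʳ (u <ᵇ v))))))

  tau<-restrict : ∀ {b r} (c : ℕ → ℕ → Bool) → b ≤ r → (∀ u l → b ≤ l → c u l ≡ true) →
    tau< m r g c ≡ tau< a b g c + edges< a g * (r ∸ b)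
  tau<-restrict {b} {r} c b≤r c-beyond = begin
    tau< m r g c
      ≡⟨ ∑<²-restrict _ a≤m (λ u v out → cong (λ x → if x then codegree< r c u v else 0)
                                               (trans (cong ((u <ᵇ v) ∧_) (g-supp u v out)) (∧-zeroʳ (u <ᵇ v)))) ⟩
    ∑< a (λ u → ∑< a (λ v → if (u <ᵇ v) ∧ g u v then codegree< r c u v else 0))
      ≡⟨ ∑<-cong a (λ u _ → ∑<-cong a λ v _ → split-codegree ((u <ᵇ v) ∧ g u v) u v) ⟩
    ∑< a (λ u → ∑< a (λ v → (if (u <ᵇ v) ∧ g u v then codegree< b c u v else 0)
                            + 𝟙 ((u <ᵇ v) ∧ g u v) * (r ∸ b)))
      ≡⟨ ∑<-cong a (λ u _ → trans (∑<-distrib-+ a _ _) (cong (_ +_) (∑<-distribʳ-* a (r ∸ b) _))) ⟩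
    ∑< a (λ u → ∑< a (λ v → if (u <ᵇ v) ∧ g u v then codegree< b c u v else 0)
                + ∑< a (λ v → 𝟙 ((u <ᵇ v) ∧ g u v)) * (r ∸ b))
      ≡⟨ trans (∑<-distrib-+ a _ _) (cong (_ +_) (∑<-distribʳ-* a (r ∸ b) _)) ⟩
    tau< a b g c + edges< a g * (r ∸ b) ∎
    where
    open ≡-Reasoning
    split-codegree : ∀ e u v → (if e then codegree< r c u v else 0)
                             ≡ (if e then codegree< b c u v else 0) + 𝟙 e * (r ∸ b)
    split-codegree false u v = refl
    split-codegree true  u v =
      trans (∑<-ones-beyond _ b≤r λ l b≤l →
               cong₂ (λ x y → 𝟙 (x ∧ y)) (c-beyond u l b≤l) (c-beyond v l b≤l))
            (cong (codegree< b c u v +_) (sym (+-identityʳ (r ∸ b))))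

∑<²-ones-outside : ∀ {a b m r} (F : ℕ → ℕ → Bool) → a ≤ m → b ≤ r →
  (∀ u l → a ≤ u ⊎ b ≤ l → F u l ≡ true) →
  ∑< m (λ u → ∑< r (λ l → 𝟙 (F u l))) + a * b ≡ ∑< a (λ u → ∑< b (λ l → 𝟙 (F u l))) + m * r
∑<²-ones-outside {a} {b} {m} {r} F a≤m b≤r F-outside = begin
  ∑< m row + a * b
    ≡⟨ cong (_+ a * b) (trans (∑<-split row a≤m) (cong₂ _+_
         (trans (∑<-cong a λ u _ → ∑<-ones-beyond _ b≤r λ l b≤l → cong 𝟙 (F-outside u l (inj₂ b≤l)))
                (trans (∑<-distrib-+ a _ _) (cong (S +_) (∑<-const a (r ∸ b)))))
         (trans (∑<-cong (m ∸ a) λ i _ →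
                   trans (∑<-cong r λ l _ → cong 𝟙 (F-outside (a + i) l (inj₁ (m≤m+n a i))))
                         (trans (∑<-const r 1) (*-identityʳ r)))
                (∑<-const (m ∸ a) r)))) ⟩
  S + a * (r ∸ b) + (m ∸ a) * r + a * b
    ≡⟨ cong (λ x → S + a * (r ∸ b) + (m ∸ a) * x + a * b) (sym (m∸n+n≡m b≤r)) ⟩
  S + a * (r ∸ b) + (m ∸ a) * (r ∸ b + b) + a * b
    ≡⟨ rearrange S a b (r ∸ b) (m ∸ a) ⟩
  S + (m ∸ a + a) * (r ∸ b + b)
    ≡⟨ cong₂ (λ x y → S + x * y) (m∸n+n≡m a≤m) (m∸n+n≡m b≤r) ⟩
  S + m * r ∎
  where
  open ≡-Reasoning
  row : ℕ → ℕ
  row u = ∑< r (λ l → 𝟙 (F u l))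
  S : ℕ
  S = ∑< a (λ u → ∑< b (λ l → 𝟙 (F u l)))
  rearrange : ∀ S a b s q → S + a * s + q * (s + b) + a * b ≡ S + (q + a) * (s + b)
  rearrange = ℕ-Solver.solve-∀

shift : ℕ → (ℕ → ℕ → Bool) → ℕ → ℕ → Bool
shift m h i j = h (m + i) (m + j)

between : ℕ → (ℕ → ℕ → Bool) → ℕ → ℕ → Bool
between m h u j = h u (m + j)

module _ (h : ℕ → ℕ → Bool) {m n : ℕ} (m≤n : m ≤ n) where

  private
    r : ℕ
    r = n ∸ m

    low<ᵇhigh : ∀ {u} j → u < m → (u <ᵇ m + j) ≡ true
    low<ᵇhigh j u<m = <⇒<ᵇ≡true (≤-trans u<m (m≤m+n m j))

    high<ᵇlow : ∀ {v} j → v < m → (m + j <ᵇ v) ≡ false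
    high<ᵇlow j v<m = ≤⇒<ᵇ≡false (≤-trans (<⇒≤ v<m) (m≤m+n m j))

  edges<-split : edges< n h
    ≡ edges< m h + ∑< m (λ u → ∑< r (λ j → 𝟙 (between m h u j))) + edges< r (shift m h)
  edges<-split = trans (∑<-split row m≤n)
    (cong₂ _+_ (trans (∑<-cong m lowRow) (∑<-distrib-+ m _ _)) (∑<-cong r λ i _ → highRow i))
    where
    row : ℕ → ℕ
    row u = ∑< n λ v → 𝟙 ((u <ᵇ v) ∧ h u v)
    lowRow : ∀ u → u < m →
      row u ≡ ∑< m (λ v → 𝟙 ((u <ᵇ v) ∧ h u v)) + ∑< r (λ j → 𝟙 (between m h u j))
    lowRow u u<m = trans (∑<-split _ m≤n) (cong (_ +_)
      (∑<-cong r λ j _ → cong (λ c → 𝟙 (c ∧ h u (m + j))) (low<ᵇhigh j u<m)))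
    highRow : ∀ i → row (m + i) ≡ ∑< r (λ j → 𝟙 ((i <ᵇ j) ∧ shift m h i j))
    highRow i = trans (∑<-split _ m≤n) (cong₂ _+_
      (∑<-zero m λ v v<m → cong (λ c → 𝟙 (c ∧ h (m + i) v)) (high<ᵇlow i v<m))
      (∑<-cong r λ j _ → cong (λ c → 𝟙 (c ∧ shift m h i j)) (+-<ᵇ m)))

  -- The four terms count the triangles of shape XXX, XXY, XYY and YYY with respect to [0, m).
  triangles<-split : triangles< n h
    ≡ triangles< m h + tau< m r h (between m h)
      + tau< r m (shift m h) (flip (between m h)) + triangles< r (shift m h)
  triangles<-split = begin
    triangles< n h
      ≡⟨ ∑<-split plane m≤n ⟩
    ∑< m plane + ∑< r (λ i → plane (m + i))
      ≡⟨ cong₂ _+_ (trans (∑<-cong m lowPlane) (trans (∑<-distrib-+ m _ _)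
                     (cong (_+ ∑< m (λ u → ∑< r (mixed u))) (∑<-distrib-+ m _ _))))
                   (∑<-cong r λ i _ → highPlane i) ⟩
    triangles< m h + tau< m r h (between m h) + ∑< m (λ u → ∑< r (mixed u)) + triangles< r (shift m h)
      ≡⟨ cong (λ z → triangles< m h + tau< m r h (between m h) + z + triangles< r (shift m h)) mixed-swap ⟩
    triangles< m h + tau< m r h (between m h)
      + tau< r m (shift m h) (flip (between m h)) + triangles< r (shift m h) ∎
    where
    open ≡-Reasoning
    T : ℕ → ℕ → ℕ → ℕ
    T u v w = 𝟙 ((u <ᵇ v) ∧ (v <ᵇ w) ∧ h u v ∧ h v w ∧ h u w)
    line : ℕ → ℕ → ℕ
    line u v = ∑< n (T u v)
    plane : ℕ → ℕ
    plane u = ∑< n (line u)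
    mixed : ℕ → ℕ → ℕ
    mixed u j = ∑< r λ l → 𝟙 ((j <ᵇ l) ∧ between m h u j ∧ shift m h j l ∧ between m h u l)

    lowLine : ∀ {u v} → u < m → v < m → line u v
      ≡ ∑< m (T u v) + (if (u <ᵇ v) ∧ h u v then codegree< r (between m h) u v else 0)
    lowLine {u} {v} u<m v<m = trans (∑<-split _ m≤n) (cong (∑< m (T u v) +_)
      (trans (∑<-cong r λ l _ →
                trans (cong (λ c → 𝟙 ((u <ᵇ v) ∧ c ∧ h u v ∧ h v (m + l) ∧ h u (m + l))) (low<ᵇhigh l v<m))
                      (𝟙[c∧x∧y∧z]≡if[c∧x]𝟙[z∧y] (u <ᵇ v) (h u v) (h v (m + l)) (h u (m + l))))
             (∑<-if r ((u <ᵇ v) ∧ h u v) λ l → 𝟙 (h u (m + l) ∧ h v (m + l)))))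

    mixedLine : ∀ {u} j → u < m → line u (m + j) ≡ mixed u j
    mixedLine {u} j u<m = trans (∑<-split _ m≤n) (cong₂ _+_
      (∑<-zero m λ w w<m → cong 𝟙 (trans
         (cong (λ c → (u <ᵇ m + j) ∧ c ∧ (h u (m + j) ∧ h (m + j) w ∧ h u w)) (high<ᵇlow j w<m))
         (∧-zeroʳ (u <ᵇ m + j))))
      (∑<-cong r λ l _ → cong₂ (λ c d → 𝟙 (c ∧ d ∧ between m h u j ∧ shift m h j l ∧ between m h u l))
         (low<ᵇhigh j u<m) (+-<ᵇ m)))

    lowPlane : ∀ u → u < m → plane u
      ≡ ∑< m (λ v → ∑< m (T u v))
        + ∑< m (λ v → if (u <ᵇ v) ∧ h u v then codegree< r (between m h) u v else 0)
        + ∑< r (mixed u)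
    lowPlane u u<m = trans (∑<-split _ m≤n) (cong₂ _+_
      (trans (∑<-cong m λ v v<m → lowLine u<m v<m) (∑<-distrib-+ m _ _))
      (∑<-cong r λ j _ → mixedLine j u<m))

    highLine : ∀ i j → line (m + i) (m + j) ≡ ∑< r λ l → 𝟙 ((i <ᵇ j) ∧ (j <ᵇ l)
                         ∧ shift m h i j ∧ shift m h j l ∧ shift m h i l)
    highLine i j = trans (∑<-split _ m≤n) (cong₂ _+_
      (∑<-zero m λ w w<m → cong 𝟙 (trans
         (cong (λ c → (m + i <ᵇ m + j) ∧ c ∧ (shift m h i j ∧ h (m + j) w ∧ h (m + i) w)) (high<ᵇlow j w<m))
         (∧-zeroʳ (m + i <ᵇ m + j))))
      (∑<-cong r λ l _ → cong₂ (λ c d → 𝟙 (c ∧ d ∧ shift m h i j ∧ shift m h j l ∧ shift m h i l))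
         (+-<ᵇ m) (+-<ᵇ m)))

    highPlane : ∀ i → plane (m + i) ≡ ∑< r λ j → ∑< r λ l → 𝟙 ((i <ᵇ j) ∧ (j <ᵇ l)
                         ∧ shift m h i j ∧ shift m h j l ∧ shift m h i l)
    highPlane i = trans (∑<-split _ m≤n) (cong₂ _+_
      (∑<-zero m λ v v<m → ∑<-zero n λ w _ →
         cong (λ c → 𝟙 (c ∧ (v <ᵇ w) ∧ h (m + i) v ∧ h v w ∧ h (m + i) w)) (high<ᵇlow i v<m))
      (∑<-cong r λ j _ → highLine i j))

    mixed-swap : ∑< m (λ u → ∑< r (mixed u)) ≡ tau< r m (shift m h) (flip (between m h))
    mixed-swap = trans (∑<-comm m r mixed) (∑<-cong r λ j _ →
      trans (∑<-comm m r (λ u l → 𝟙 ((j <ᵇ l) ∧ between m h u j ∧ shift m h j l ∧ between m h u l)))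
            (∑<-cong r λ l _ →
               trans (∑<-cong m λ u _ →
                        𝟙[c∧x∧d∧y]≡if[c∧d]𝟙[x∧y] (j <ᵇ l) (between m h u j)
                                                  (shift m h j l) (between m h u l))
                     (∑<-if m ((j <ᵇ l) ∧ shift m h j l) λ u → 𝟙 (between m h u j ∧ between m h u l))))

-- Counting in H_n(P,Q,R)

module _ (n : ℕ) {a b : ℕ} (P : Graph a) (Q : Graph b) (R : BipGraph a b) {u v : ℕ} where

  Hadj-XX : u < n / 2 → v < n / 2 → Hadj n P Q R u v ≡ inside P u v
  Hadj-XX u<m v<m rewrite <⇒<ᵇ≡true u<m | <⇒<ᵇ≡true v<m = refl

  Hadj-YY : n / 2 ≤ u → n / 2 ≤ v → Hadj n P Q R u v ≡ inside Q (u ∸ n / 2) (v ∸ n / 2)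
  Hadj-YY m≤u m≤v rewrite ≤⇒<ᵇ≡false m≤u | ≤⇒<ᵇ≡false m≤v = refl

  Hadj-XY : u < n / 2 → n / 2 ≤ v → Hadj n P Q R u v ≡ cross R u (v ∸ n / 2)
  Hadj-XY u<m m≤v rewrite <⇒<ᵇ≡true u<m | ≤⇒<ᵇ≡false m≤v = refl

  Hadj-YX : n / 2 ≤ u → v < n / 2 → Hadj n P Q R u v ≡ cross R v (u ∸ n / 2)
  Hadj-YX m≤u v<m rewrite ≤⇒<ᵇ≡false m≤u | <⇒<ᵇ≡true v<m = refl

Hadj-sym : ∀ n {a b} (P : Graph a) (Q : Graph b) (R : BipGraph a b) u v → Hadj n P Q R u v ≡ Hadj n P Q R v u
Hadj-sym n P Q R u v with u <ᵇ n / 2 | v <ᵇ n / 2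
... | true  | true  = inside-sym P u v
... | true  | false = refl
... | false | true  = refl
... | false | false = inside-sym Q (u ∸ n / 2) (v ∸ n / 2)

module _ (n : ℕ) {a b : ℕ} (P : Graph a) (Q : Graph b) (R : BipGraph a b)
         (a≤m : a ≤ n / 2) (b≤r : b ≤ n ∸ n / 2) where

  private
    m r : ℕ
    m = n / 2
    r = n ∸ n / 2

    h : ℕ → ℕ → Bool
    h = Hadj n P Q R

    m≤n : m ≤ n
    m≤n = m/n≤m n 2

    h-between : ∀ {u} j → u < m → between m h u j ≡ cross R u j
    h-between {u} j u<m = trans (Hadj-XY n P Q R u<m (m≤m+n m j)) (cong (cross R u) (m+n∸m≡n m j))

    h-high : ∀ i j → shift m h i j ≡ inside Q i j
    h-high i j = trans (Hadj-YY n P Q R (m≤m+n m i) (m≤m+n m j))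
                       (cong₂ (inside Q) (m+n∸m≡n m i) (m+n∸m≡n m j))

    E≡h : ∀ i j → (toℕ i <ᵇ toℕ j) ≡ true → E (H n P Q R) i j ≡ h (toℕ i) (toℕ j)
    E≡h = E-above-diagonal (H n P Q R)

    low≡P : ∀ u v → u < m → v < m → h u v ≡ inside P u v
    low≡P u v u<m v<m = Hadj-XX n P Q R u<m v<m

    high≡Q : ∀ i j → i < r → j < r → shift m h i j ≡ inside Q i j
    high≡Q i j _ _ = h-high i j

    edges-low : edges< m h ≡ edges P
    edges-low = trans (edges<-cong m low≡P)
               (trans (edges<-restrict (inside P) a≤m (inside-supported P))
                      (sym (edges≡edges< P (inside P) (E≡inside P))))

    edges-high : edges< r (shift m h) ≡ edges Q
    edges-high = trans (edges<-cong r high≡Q)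
                (trans (edges<-restrict (inside Q) b≤r (inside-supported Q))
                       (sym (edges≡edges< Q (inside Q) (E≡inside Q))))

    edges-between : ∑< m (λ u → ∑< r (λ j → 𝟙 (between m h u j))) + a * b ≡ eR R + m * r
    edges-between = begin
      ∑< m (λ u → ∑< r (λ j → 𝟙 (between m h u j))) + a * b
        ≡⟨ cong (_+ a * b) (∑<-cong m λ u u<m → ∑<-cong r λ j _ → cong 𝟙 (h-between j u<m)) ⟩
      ∑< m (λ u → ∑< r (λ j → 𝟙 (cross R u j))) + a * b
        ≡⟨ ∑<²-ones-outside (cross R) a≤m b≤r (cross-outside R) ⟩
      ∑< a (λ u → ∑< b (λ j → 𝟙 (cross R u j))) + m * r
        ≡⟨ cong (_+ m * r) (sym (eR≡∑<² R)) ⟩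
      eR R + m * r ∎
      where open ≡-Reasoning

    triangles-low : triangles< m h ≡ triangles P
    triangles-low = trans (triangles<-cong m low≡P)
                   (trans (triangles<-restrict (inside P) a≤m (inside-supported P))
                          (sym (triangles≡triangles< P (inside P) (E≡inside P))))

    triangles-high : triangles< r (shift m h) ≡ triangles Q
    triangles-high = trans (triangles<-cong r high≡Q)
                    (trans (triangles<-restrict (inside Q) b≤r (inside-supported Q))
                           (sym (triangles≡triangles< Q (inside Q) (E≡inside Q))))

    tau-low : tau< m r h (between m h) ≡ tauPart P R + edges P * (r ∸ b)
    tau-low = begin
      tau< m r h (between m h)
        ≡⟨ tau<-cong m r low≡P (λ u j u<m _ → h-between j u<m) ⟩
      tau< m r (inside P) (cross R)
        ≡⟨ tau<-restrict (inside P) a≤m (inside-supported P) (cross R) b≤r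
                         (λ u l b≤l → cross-outside R u l (inj₂ b≤l)) ⟩
      tau< a b (inside P) (cross R) + edges< a (inside P) * (r ∸ b)
        ≡⟨ cong₂ (λ x y → x + y * (r ∸ b)) (sym (tauPart≡tau< P R (cross R) (cross-toℕ R)))
                                           (sym (edges≡edges< P (inside P) (E≡inside P))) ⟩
      tauPart P R + edges P * (r ∸ b) ∎
      where open ≡-Reasoning

    tau-high : tau< r m (shift m h) (flip (between m h)) ≡ tauPart Q (transposeB R) + edges Q * (m ∸ a)
    tau-high = begin
      tau< r m (shift m h) (flip (between m h))
        ≡⟨ tau<-cong r m high≡Q (λ j u _ u<m → h-between j u<m) ⟩
      tau< r m (inside Q) (flip (cross R))
        ≡⟨ tau<-restrict (inside Q) b≤r (inside-supported Q) (flip (cross R)) a≤m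
                         (λ j u a≤u → cross-outside R u j (inj₁ a≤u)) ⟩
      tau< b a (inside Q) (flip (cross R)) + edges< b (inside Q) * (m ∸ a)
        ≡⟨ cong₂ (λ x y → x + y * (m ∸ a))
                 (sym (tauPart≡tau< Q (transposeB R) (flip (cross R)) (λ y x → cross-toℕ R x y)))
                 (sym (edges≡edges< Q (inside Q) (E≡inside Q))) ⟩
      tauPart Q (transposeB R) + edges Q * (m ∸ a) ∎
      where open ≡-Reasoning

  edges-H : edges (H n P Q R) + a * b ≡ edges P + edges Q + eR R + n / 2 * (n ∸ n / 2)
  edges-H = begin
    edges (H n P Q R) + a * b
      ≡⟨ cong (_+ a * b) (trans (edges≡edges< (H n P Q R) h E≡h) (edges<-split h m≤n)) ⟩
    edges< m h + C + edges< r (shift m h) + a * b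
      ≡⟨ cong₂ (λ x y → x + C + y + a * b) edges-low edges-high ⟩
    edges P + C + edges Q + a * b
      ≡⟨ rearrange (edges P) C (edges Q) (a * b) ⟩
    edges P + edges Q + (C + a * b)
      ≡⟨ cong (edges P + edges Q +_) edges-between ⟩
    edges P + edges Q + (eR R + m * r)
      ≡⟨ sym (+-assoc (edges P + edges Q) (eR R) (m * r)) ⟩
    edges P + edges Q + eR R + m * r ∎
    where
    open ≡-Reasoning
    C : ℕ
    C = ∑< m (λ u → ∑< r (λ j → 𝟙 (between m h u j)))
    rearrange : ∀ x y z w → x + y + z + w ≡ x + z + (y + w)
    rearrange = ℕ-Solver.solve-∀

  triangles-H : triangles (H n P Q R)
    ≡ triangles P + triangles Q + tau P Q R + edges P * (n ∸ n / 2 ∸ b) + edges Q * (n / 2 ∸ a)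
  triangles-H = begin
    triangles (H n P Q R)
      ≡⟨ trans (triangles≡triangles< (H n P Q R) h E≡h) (triangles<-split h m≤n) ⟩
    triangles< m h + tau< m r h (between m h) + tau< r m (shift m h) (flip (between m h))
      + triangles< r (shift m h)
      ≡⟨ cong₂ _+_ (cong₂ _+_ (cong₂ _+_ triangles-low tau-low) tau-high) triangles-high ⟩
    triangles P + (tauPart P R + edges P * (r ∸ b)) + (tauPart Q (transposeB R) + edges Q * (m ∸ a))
      + triangles Q
      ≡⟨ rearrange (triangles P) (tauPart P R) (edges P * (r ∸ b)) (tauPart Q (transposeB R))
                   (edges Q * (m ∸ a)) (triangles Q) ⟩
    triangles P + triangles Q + tau P Q R + edges P * (r ∸ b) + edges Q * (m ∸ a) ∎
    where
    open ≡-Reasoning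
    rearrange : ∀ x y z u v w → x + (y + z) + (u + v) + w ≡ x + w + (y + u) + z + v
    rearrange = ℕ-Solver.solve-∀

-- F_k-freeness of H_n(P,Q,R)

DisjointPairs : ∀ {k} → (Fin k → ℕ) → (Fin k → ℕ) → Set
DisjointPairs X Y =
  (∀ {i j} → X i ≡ X j → i ≡ j) × (∀ {i j} → Y i ≡ Y j → i ≡ j) × (∀ i j → X i ≢ Y j)

data Covered {α β : ℕ} (ι : Fin α → ℕ) (κ : Fin β → ℕ) (S : Fin α → Bool) (G : Graph β)
             (T : Fin β → Bool) (u v : ℕ) : Set where
  coveredˡ : ∀ s → ι s ≡ u → S s ≡ true → Covered ι κ S G T u v
  coveredʳ : ∀ s → ι s ≡ v → S s ≡ true → Covered ι κ S G T u v
  matched  : ∀ p q → κ p ≡ u → κ q ≡ v → E G p q ≡ true → T p ≡ true → T q ≡ true →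
             Covered ι κ S G T u v

module _ {α β : ℕ} {ι : Fin α → ℕ} {κ : Fin β → ℕ} {S : Fin α → Bool} {G : Graph β} {T : Fin β → Bool}
         where

  private
    OnPairs : ∀ {k} → (Fin k → ℕ) → (Fin k → ℕ) → ℕ → Set
    OnPairs {k} X Y w = Σ (Fin k) λ j → X j ≡ w ⊎ Y j ≡ w

    record Collection {k} (X Y : Fin k → ℕ) : Set where
      field
        hits             : List (Fin α)
        matching         : List (Fin β × Fin β)
        hits-unique      : Unique hits
        hits-in-S        : All (λ s → S s ≡ true) hits
        matching-ok      : IsMatchingIn G T matching
        size             : length hits + length matching ≡ k
        hits-on-pairs    : All (λ s → OnPairs X Y (ι s)) hits
        matched-on-pairs : All (λ p → OnPairs X Y (κ p)) (endpoints matching)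

    widen : ∀ {k} {X Y : Fin (suc k) → ℕ} {w} → OnPairs (λ j → X (suc j)) (λ j → Y (suc j)) w → OnPairs X Y w
    widen (j , e) = suc j , e

    tail-disjoint : ∀ {k} {X Y : Fin (suc k) → ℕ} → DisjointPairs X Y →
      DisjointPairs (λ j → X (suc j)) (λ j → Y (suc j))
    tail-disjoint (X-inj , Y-inj , X≢Y) =
      (λ e → Fin.suc-injective (X-inj e)) , (λ e → Fin.suc-injective (Y-inj e)) , (λ i j → X≢Y (suc i) (suc j))

    fresh-head : ∀ {γ k} {X Y : Fin (suc k) → ℕ} → DisjointPairs X Y → (f : Fin γ → ℕ) →
      ∀ {L} → All (λ s → OnPairs (λ j → X (suc j)) (λ j → Y (suc j)) (f s)) L →
      ∀ {s} → f s ≡ X zero ⊎ f s ≡ Y zero → All (s ≢_) L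
    fresh-head {X = X} {Y} (X-inj , Y-inj , X≢Y) f on fs≡head =
      All.map (λ where (j , e) refl → clash j e fs≡head) on
      where
      clash : ∀ {w} j → X (suc j) ≡ w ⊎ Y (suc j) ≡ w → w ≡ X zero ⊎ w ≡ Y zero → ⊥
      clash j (inj₁ Xj≡w) (inj₁ w≡X0) with X-inj (trans Xj≡w w≡X0)
      ... | ()
      clash j (inj₁ Xj≡w) (inj₂ w≡Y0) = X≢Y (suc j) zero (trans Xj≡w w≡Y0)
      clash j (inj₂ Yj≡w) (inj₁ w≡X0) = X≢Y zero (suc j) (sym (trans Yj≡w w≡X0))
      clash j (inj₂ Yj≡w) (inj₂ w≡Y0) with Y-inj (trans Yj≡w w≡Y0)
      ... | ()

    extend : ∀ {k} {X Y : Fin (suc k) → ℕ} → DisjointPairs X Y → Covered ι κ S G T (X zero) (Y zero) →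
      Collection (λ j → X (suc j)) (λ j → Y (suc j)) → Collection X Y
    extend disjoint (coveredˡ s ιs≡X0 Ss) C = record
      { hits = s ∷ hits ; matching = matching
      ; hits-unique = fresh-head disjoint ι hits-on-pairs (inj₁ ιs≡X0) ∷ hits-unique
      ; hits-in-S = Ss ∷ hits-in-S ; matching-ok = matching-ok ; size = cong suc size
      ; hits-on-pairs = (zero , inj₁ (sym ιs≡X0)) ∷ All.map widen hits-on-pairs
      ; matched-on-pairs = All.map widen matched-on-pairs }
      where open Collection C
    extend disjoint (coveredʳ s ιs≡Y0 Ss) C = record
      { hits = s ∷ hits ; matching = matching
      ; hits-unique = fresh-head disjoint ι hits-on-pairs (inj₂ ιs≡Y0) ∷ hits-unique
      ; hits-in-S = Ss ∷ hits-in-S ; matching-ok = matching-ok ; size = cong suc size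
      ; hits-on-pairs = (zero , inj₂ (sym ιs≡Y0)) ∷ All.map widen hits-on-pairs
      ; matched-on-pairs = All.map widen matched-on-pairs }
      where open Collection C
    extend disjoint@(_ , _ , X≢Y) (matched p q κp≡X0 κq≡Y0 Epq Tp Tq) C = record
      { hits = hits ; matching = (p , q) ∷ matching
      ; hits-unique = hits-unique ; hits-in-S = hits-in-S
      ; matching-ok = (Epq , Tp , Tq) ∷ proj₁ matching-ok
                    , (p≢q ∷ fresh-head disjoint κ matched-on-pairs (inj₁ κp≡X0))
                    ∷ fresh-head disjoint κ matched-on-pairs (inj₂ κq≡Y0) ∷ proj₂ matching-ok
      ; size = trans (+-suc (length hits) (length matching)) (cong suc size)
      ; hits-on-pairs = All.map widen hits-on-pairs
      ; matched-on-pairs =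
          (zero , inj₁ (sym κp≡X0)) ∷ (zero , inj₂ (sym κq≡Y0)) ∷ All.map widen matched-on-pairs }
      where
      open Collection C
      p≢q : p ≢ q
      p≢q refl = X≢Y zero zero (trans (sym κp≡X0) κq≡Y0)

    collect : ∀ {k} (X Y : Fin k → ℕ) → DisjointPairs X Y → (∀ i → Covered ι κ S G T (X i) (Y i)) →
      Collection X Y
    collect {zero} X Y _ _ = record
      { hits = [] ; matching = [] ; hits-unique = [] ; hits-in-S = [] ; matching-ok = [] , []
      ; size = refl ; hits-on-pairs = [] ; matched-on-pairs = [] }
    collect {suc k} X Y disjoint cover =
      extend disjoint (cover zero)
             (collect (λ j → X (suc j)) (λ j → Y (suc j)) (tail-disjoint disjoint) (λ i → cover (suc i)))

  -- The S-endpoints of the covered pairs are distinct as the pairs are disjoint; the other pairs form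
  -- a matching.
  large-link⇒large-matching : ∀ {k} (X Y : Fin k → ℕ) → DisjointPairs X Y →
    (∀ i → Covered ι κ S G T (X i) (Y i)) → ∃ λ M → IsMatchingIn G T M × k ≤ countF S + length M
  large-link⇒large-matching X Y disjoint cover =
    matching , matching-ok ,
    subst (_≤ countF S + length matching) size
          (+-monoˡ-≤ (length matching) (unique-length≤countF S hits hits-unique hits-in-S))
    where open Collection (collect X Y disjoint cover)

Y-vertex : ℕ → ∀ {b} → Fin b → ℕ
Y-vertex n y = n / 2 + toℕ y

module _ (n : ℕ) {a b : ℕ} (P : Graph a) (Q : Graph b) (R : BipGraph a b) where

  private
    h : ℕ → ℕ → Bool
    h = Hadj n P Q R

    m : ℕ
    m = n / 2

    Y-vertex-∸ : ∀ {y : Fin b} {w} → toℕ y ≡ w ∸ m → m ≤ w → Y-vertex n y ≡ w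
    Y-vertex-∸ y≡ m≤w = trans (cong (m +_) y≡) (m+[n∸m]≡n m≤w)

    neighbour-X : ∀ {c w} → c < m → w < m → h c w ≡ true →
      ∃ λ s → toℕ s ≡ w × inside P c (toℕ s) ≡ true
    neighbour-X {c} {w} c<m w<m cw =
      let _ , s , _ , s≡w , _ = inside≡true⇒E P c w cw′ in s , s≡w , trans (cong (inside P c) s≡w) cw′
      where
      cw′ : inside P c w ≡ true
      cw′ = trans (sym (Hadj-XX n P Q R c<m w<m)) cw

    neighbour-Y : ∀ {c w} → m ≤ c → m ≤ w → h c w ≡ true →
      ∃ λ s → Y-vertex n s ≡ w × inside Q (c ∸ m) (toℕ s) ≡ true
    neighbour-Y {c} {w} m≤c m≤w cw =
      let _ , s , _ , s≡ , _ = inside≡true⇒E Q (c ∸ m) (w ∸ m) cw′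
      in s , Y-vertex-∸ s≡ m≤w , trans (cong (inside Q (c ∸ m)) s≡) cw′
      where
      cw′ : inside Q (c ∸ m) (w ∸ m) ≡ true
      cw′ = trans (sym (Hadj-YY n P Q R m≤c m≤w)) cw

    edge-X : ∀ {u v} → u < m → v < m → h u v ≡ true →
      ∃₂ λ p q → toℕ p ≡ u × toℕ q ≡ v × E P p q ≡ true
    edge-X {u} {v} u<m v<m uv = inside≡true⇒E P u v (trans (sym (Hadj-XX n P Q R u<m v<m)) uv)

    edge-Y : ∀ {u v} → m ≤ u → m ≤ v → h u v ≡ true →
      ∃₂ λ p q → toℕ p ≡ u ∸ m × toℕ q ≡ v ∸ m × E Q p q ≡ true
    edge-Y {u} {v} m≤u m≤v uv = inside≡true⇒E Q (u ∸ m) (v ∸ m) (trans (sym (Hadj-YY n P Q R m≤u m≤v)) uv)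

  link-X : ∀ {c u v} → c < n / 2 → h c u ≡ true → h c v ≡ true → h u v ≡ true →
    Covered toℕ (Y-vertex n) (λ (s : Fin a) → inside P c (toℕ s)) Q (λ p → cross R c (toℕ p)) u v
  link-X {c} {u} {v} c<m cu cv uv with u <? m | v <? m
  ... | yes u<m | _       = let s , s≡u , Ss = neighbour-X c<m u<m cu in coveredˡ s s≡u Ss
  ... | no _    | yes v<m = let s , s≡v , Ss = neighbour-X c<m v<m cv in coveredʳ s s≡v Ss
  ... | no u≮m  | no v≮m  =
    let p , q , p≡ , q≡ , Epq = edge-Y (≮⇒≥ u≮m) (≮⇒≥ v≮m) uv
    in matched p q (Y-vertex-∸ p≡ (≮⇒≥ u≮m)) (Y-vertex-∸ q≡ (≮⇒≥ v≮m)) Epq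
                   (across p≡ (≮⇒≥ u≮m) cu) (across q≡ (≮⇒≥ v≮m) cv)
    where
    across : ∀ {p w} → toℕ p ≡ w ∸ m → m ≤ w → h c w ≡ true → cross R c (toℕ p) ≡ true
    across p≡ m≤w cw = trans (cong (cross R c) p≡) (trans (sym (Hadj-XY n P Q R c<m m≤w)) cw)

  link-Y : ∀ {c u v} → n / 2 ≤ c → h c u ≡ true → h c v ≡ true → h u v ≡ true →
    Covered (Y-vertex n) toℕ (λ s → inside Q (c ∸ n / 2) (toℕ s))
            P (λ (p : Fin a) → cross (transposeB R) (c ∸ n / 2) (toℕ p)) u v
  link-Y {c} {u} {v} m≤c cu cv uv with u <? m | v <? m
  ... | no u≮m | _      = let s , s≡u , Ss = neighbour-Y m≤c (≮⇒≥ u≮m) cu in coveredˡ s s≡u Ss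
  ... | yes _  | no v≮m = let s , s≡v , Ss = neighbour-Y m≤c (≮⇒≥ v≮m) cv in coveredʳ s s≡v Ss
  ... | yes u<m | yes v<m =
    let p , q , p≡ , q≡ , Epq = edge-X u<m v<m uv
    in matched p q p≡ q≡ Epq (across p≡ u<m cu) (across q≡ v<m cv)
    where
    across : ∀ {p w} → toℕ p ≡ w → w < m → h c w ≡ true → cross (transposeB R) (c ∸ m) (toℕ p) ≡ true
    across {p} {w} p≡ w<m cw = trans (cross-transpose R (c ∸ m) (toℕ p))
      (trans (cong (λ x → cross R x (c ∸ m)) p≡) (trans (sym (Hadj-YX n P Q R m≤c w<m)) cw))

LinkBounded : ∀ {a b} → Graph a → Graph b → BipGraph a b → ℕ → ℕ → Set
LinkBounded {a} P Q R d c = ∀ M → IsMatchingIn Q (λ p → cross R c (toℕ p)) M →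
  countF {a} (λ s → inside P c (toℕ s)) + length M ≤ d

-- Outside A the vertex c has no P-neighbours and is joined to all of B, so there ν(Q) ≤ d is what counts.
link-bounded : ∀ {a b d} {P : Graph a} {Q : Graph b} {R : BipGraph a b} →
  (∀ x M → IsMatchingIn Q (R x) M → deg P x + length M ≤ d) → MatchLE Q allV d →
  ∀ c → LinkBounded P Q R d c
link-bounded {a} {d = d} {P} {Q} {R} deg+ν≤d ν≤d c = by-cases (c <? a)
  where
  inA : ∀ x → LinkBounded P Q R d (toℕ x)
  inA x M M-ok = subst (λ z → z + length M ≤ d) (countF-cong {a} (λ s → sym (inside-toℕ P x s)))
                       (deg+ν≤d x M (IsMatchingIn-mono (λ p Tp → trans (sym (cross-toℕ R x p)) Tp) M-ok))
  by-cases : Dec (c < a) → LinkBounded P Q R d c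
  by-cases (yes c<a) = subst (LinkBounded P Q R d) (toℕ-fromℕ< c<a) (inA (fromℕ< c<a))
  by-cases (no c≮a) M M-ok = subst (λ z → z + length M ≤ d)
    (sym (countF-false {a} (λ s → inside-supported P c (toℕ s) (inj₁ (≮⇒≥ c≮a)))))
    (ν≤d M (IsMatchingIn-mono (λ _ _ → refl) M-ok))

centre : ∀ k {n} → (Fin (suc (k + k)) → Fin n) → Fin n
centre k φ = φ zero

petalˡ petalʳ : ∀ k {n} → (Fin (suc (k + k)) → Fin n) → Fin k → Fin n
petalˡ k φ i = φ (suc (i ↑ˡ k))
petalʳ k φ i = φ (suc (k ↑ʳ i))

module _ {k n} {φ : Fin (suc (k + k)) → Fin n} (φ-injective : ∀ i j → φ i ≡ φ j → i ≡ j) where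

  petalˡ-injective : ∀ {i j} → petalˡ k φ i ≡ petalˡ k φ j → i ≡ j
  petalˡ-injective e = ↑ˡ-injective k _ _ (Fin.suc-injective (φ-injective _ _ e))

  petalʳ-injective : ∀ {i j} → petalʳ k φ i ≡ petalʳ k φ j → i ≡ j
  petalʳ-injective e = ↑ʳ-injective k _ _ (Fin.suc-injective (φ-injective _ _ e))

  petalˡ≢petalʳ : ∀ i j → petalˡ k φ i ≢ petalʳ k φ j
  petalˡ≢petalʳ i j e with trans (sym (splitAt-↑ˡ k i k))
                                 (trans (cong (splitAt k) (Fin.suc-injective (φ-injective _ _ e))) (splitAt-↑ʳ k k j))
  ... | ()

H-FkFree : ∀ {k fv} n {a b} (P : Graph a) (Q : Graph b) (R : BipGraph a b) →
  1 ≤ k → Admissible k fv P Q R → FkFree k (H n P Q R)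
H-FkFree {suc k} n {a} {b} P Q R _ ((_ , ν[P]≤k , _) , (_ , ν[Q]≤k , _) , link-A , link-B)
         φ (φ-injective , petals) =
  centre-cases (c <? n / 2)
  where
  c : ℕ
  c = toℕ (centre (suc k) φ)
  X Y : Fin (suc k) → ℕ
  X i = toℕ (petalˡ (suc k) φ i)
  Y i = toℕ (petalʳ (suc k) φ i)

  disjoint : DisjointPairs X Y
  disjoint = (λ e → petalˡ-injective φ-injective (toℕ-injective e))
           , (λ e → petalʳ-injective φ-injective (toℕ-injective e))
           , (λ i j e → petalˡ≢petalʳ φ-injective i j (toℕ-injective e))

  adjacent : ∀ {i j} → E (H n P Q R) i j ≡ true → Hadj n P Q R (toℕ i) (toℕ j) ≡ true
  adjacent {i} {j} = E≡true⇒raw≡true (H n P Q R) (λ i j → Hadj-sym n P Q R (toℕ i) (toℕ j)) i j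
  c~X : ∀ i → Hadj n P Q R c (X i) ≡ true
  c~X i = adjacent (proj₁ (petals i))
  c~Y : ∀ i → Hadj n P Q R c (Y i) ≡ true
  c~Y i = adjacent (proj₁ (proj₂ (petals i)))
  X~Y : ∀ i → Hadj n P Q R (X i) (Y i) ≡ true
  X~Y i = adjacent (proj₂ (proj₂ (petals i)))

  no-large-link : ∀ {α β} {S : Fin α → Bool} {G : Graph β} {T : Fin β → Bool} →
    (∃ λ M → IsMatchingIn G T M × suc k ≤ countF S + length M) →
    (∀ M → IsMatchingIn G T M → countF S + length M ≤ k) → ⊥
  no-large-link (M , M-ok , k<) bound = <-irrefl refl (≤-trans k< (bound M M-ok))

  centre-cases : Dec (c < n / 2) → ⊥
  centre-cases (yes c<m) = no-large-link {a} {b}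
    (large-link⇒large-matching X Y disjoint λ i → link-X n P Q R c<m (c~X i) (c~Y i) (X~Y i))
    (link-bounded link-A ν[Q]≤k c)
  centre-cases (no c≮m) = no-large-link {b} {a}
    (large-link⇒large-matching X Y disjoint λ i → link-Y n P Q R (≮⇒≥ c≮m) (c~X i) (c~Y i) (X~Y i))
    (link-bounded link-B ν[P]≤k (c ∸ n / 2))

-- The value of H_n(P,Q,R)

open import Data.Integer using (ℤ; +_; _-_) renaming (_+_ to _+ℤ_; _*_ to _*ℤ_; _≤_ to _≤ℤ_)
open import Data.Integer.Properties using (pos-+; pos-*) renaming (≤-reflexive to ≤ℤ-reflexive)
import Data.Integer.Tactic.RingSolver as ℤ-Solver

⌊n²/4⌋≡⌊n/2⌋*⌈n/2⌉ : ∀ n → (n * n) / 4 ≡ n / 2 * (n ∸ n / 2)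
⌊n²/4⌋≡⌊n/2⌋*⌈n/2⌉ n = begin
  (n * n) / 4                     ≡⟨ cong (_/ 4) (cong₂ _*_ n≡p+2m n≡p+2m) ⟩
  ((p + m * 2) * (p + m * 2)) / 4 ≡⟨ cong (_/ 4) (square p m) ⟩
  (m * (m + p) * 4 + p * p) / 4   ≡⟨ +-distrib-/-∣ˡ (p * p) (n∣m*n (m * (m + p))) ⟩
  m * (m + p) * 4 / 4 + p * p / 4 ≡⟨ cong₂ _+_ (m*n/n≡m (m * (m + p)) 4) (m<n⇒m/n≡0 p*p<4) ⟩
  m * (m + p) + 0                 ≡⟨ +-identityʳ _ ⟩
  m * (m + p)                     ≡⟨ cong (m *_) (sym n∸m≡m+p) ⟩
  m * (n ∸ m)                     ∎
  where
  open ≡-Reasoning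
  m p : ℕ
  m = n / 2
  p = n % 2
  n≡p+2m : n ≡ p + m * 2
  n≡p+2m = m≡m%n+[m/n]*n n 2
  p≤1 : p ≤ 1
  p≤1 = s≤s⁻¹ (m%n<n n 2)
  p*p<4 : p * p < 4
  p*p<4 = <-≤-trans (s≤s (*-mono-≤ p≤1 p≤1)) (s≤s (s≤s z≤n))
  square : ∀ p m → (p + m * 2) * (p + m * 2) ≡ m * (m + p) * 4 + p * p
  square = ℕ-Solver.solve-∀
  n∸m≡m+p : n ∸ m ≡ m + p
  n∸m≡m+p = trans (cong (_∸ m) (trans n≡p+2m (split p m))) (m+n∸n≡m (m + p) m)
    where
    split : ∀ p m → p + m * 2 ≡ m + p + m
    split = ℕ-Solver.solve-∀

halves-fit : ∀ a b n → 2 * (a + b) ≤ n → a ≤ n / 2 × b ≤ n ∸ n / 2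
halves-fit a b n 2[a+b]≤n = m+n≤o⇒m≤o a a+b≤m , ≤-trans (m+n≤o⇒n≤o a a+b≤m) m≤r
  where
  a+b≤m : a + b ≤ n / 2
  a+b≤m = subst (_≤ n / 2) (trans (cong (_/ 2) (*-comm 2 (a + b))) (m*n/n≡m (a + b) 2)) (/-monoˡ-≤ 2 2[a+b]≤n)
  m≤r : n / 2 ≤ n ∸ n / 2
  m≤r = m+n≤o⇒m≤o∸n (n / 2) (subst (_≤ n) (double (n / 2)) (m/n*n≤m n 2))
    where
    double : ∀ x → x * 2 ≡ x + x
    double = ℕ-Solver.solve-∀

pos-isolate : ∀ x y {z : ℤ} → + (x + y) ≡ z → + x ≡ z - + y
pos-isolate x y refl = trans (x≡[x+y]-y (+ x) (+ y)) (cong (_- + y) (sym (pos-+ x y)))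
  where
  x≡[x+y]-y : ∀ x y → x ≡ (x +ℤ y) - y
  x≡[x+y]-y = ℤ-Solver.solve-∀

value-identity : ∀ (t e tri ab f2 er mr fab tP tQ τ fn : ℕ) →
  e + ab ≡ f2 + er + mr → tri + fab ≡ tP + tQ + τ + fn →
  + (t * e + tri) ≡ + t *ℤ + mr +ℤ + fn +ℤ (((+ f2 - + ab) +ℤ + er) *ℤ + t - + fab +ℤ + tP +ℤ + tQ +ℤ + τ)
value-identity t e tri ab f2 er mr fab tP tQ τ fn e+ab≡ tri+fab≡ = begin
  + (t * e + tri)
    ≡⟨ trans (pos-+ (t * e) tri) (cong (_+ℤ + tri) (pos-* t e)) ⟩
  + t *ℤ + e +ℤ + tri
    ≡⟨ cong₂ (λ x y → + t *ℤ x +ℤ y) (pos-isolate e ab e≡) (pos-isolate tri fab tri≡) ⟩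
  + t *ℤ ((+ f2 +ℤ + er +ℤ + mr) - + ab) +ℤ ((+ tP +ℤ + tQ +ℤ + τ +ℤ + fn) - + fab)
    ≡⟨ rearrange (+ t) (+ f2) (+ er) (+ mr) (+ ab) (+ tP) (+ tQ) (+ τ) (+ fn) (+ fab) ⟩
  + t *ℤ + mr +ℤ + fn +ℤ (((+ f2 - + ab) +ℤ + er) *ℤ + t - + fab +ℤ + tP +ℤ + tQ +ℤ + τ) ∎
  where
  open ≡-Reasoning
  e≡ : + (e + ab) ≡ + f2 +ℤ + er +ℤ + mr
  e≡ = trans (cong +_ e+ab≡) (trans (pos-+ (f2 + er) mr) (cong (_+ℤ + mr) (pos-+ f2 er)))
  tri≡ : + (tri + fab) ≡ + tP +ℤ + tQ +ℤ + τ +ℤ + fn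
  tri≡ = trans (cong +_ tri+fab≡) (trans (pos-+ (tP + tQ + τ) fn)
           (cong (_+ℤ + fn) (trans (pos-+ (tP + tQ) τ) (cong (_+ℤ + τ) (pos-+ tP tQ)))))
  rearrange : ∀ t f2 er mr ab tP tQ τ fn fab →
    t *ℤ ((f2 +ℤ er +ℤ mr) - ab) +ℤ ((tP +ℤ tQ +ℤ τ +ℤ fn) - fab)
    ≡ t *ℤ mr +ℤ fn +ℤ (((f2 - ab) +ℤ er) *ℤ t - fab +ℤ tP +ℤ tQ +ℤ τ)
  rearrange = ℤ-Solver.solve-∀

value-H : ∀ t fv n {a b} (P : Graph a) (Q : Graph b) (R : BipGraph a b) →
  edges P ≡ fv → edges Q ≡ fv → 2 * (a + b) ≤ n →
  + value t (H n P Q R) ≡ + (t * ((n * n) / 4)) +ℤ + (fv * n) +ℤ Φ fv P Q R t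
value-H t fv n {a} {b} P Q R eP≡fv eQ≡fv 2[a+b]≤n = begin
  + value t (H n P Q R)
    ≡⟨ value-identity t _ _ (a * b) (2 * fv) (eR R) (m * r) (fv * (a + b)) _ _ (tau P Q R) (fv * n)
                      edges≡ triangles≡ ⟩
  + t *ℤ + (m * r) +ℤ + (fv * n) +ℤ Φ fv P Q R t
    ≡⟨ cong (λ x → x +ℤ + (fv * n) +ℤ Φ fv P Q R t)
            (trans (sym (pos-* t (m * r))) (cong (λ x → + (t * x)) (sym (⌊n²/4⌋≡⌊n/2⌋*⌈n/2⌉ n)))) ⟩
  + (t * ((n * n) / 4)) +ℤ + (fv * n) +ℤ Φ fv P Q R t ∎
  where
  open ≡-Reasoning
  m r : ℕ
  m = n / 2
  r = n ∸ n / 2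
  a≤m = proj₁ (halves-fit a b n 2[a+b]≤n)
  b≤r = proj₂ (halves-fit a b n 2[a+b]≤n)
  edges≡ : edges (H n P Q R) + a * b ≡ 2 * fv + eR R + m * r
  edges≡ = trans (edges-H n P Q R a≤m b≤r)
                 (cong₂ (λ x y → x + y + eR R + m * r) eP≡fv (trans eQ≡fv (sym (+-identityʳ fv))))
  triangles≡ : triangles (H n P Q R) + fv * (a + b) ≡ triangles P + triangles Q + tau P Q R + fv * n
  triangles≡ = begin
    triangles (H n P Q R) + fv * (a + b)
      ≡⟨ cong (_+ fv * (a + b)) (triangles-H n P Q R a≤m b≤r) ⟩
    T + edges P * (r ∸ b) + edges Q * (m ∸ a) + fv * (a + b)
      ≡⟨ cong₂ (λ x y → T + x * (r ∸ b) + y * (m ∸ a) + fv * (a + b)) eP≡fv eQ≡fv ⟩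
    T + fv * (r ∸ b) + fv * (m ∸ a) + fv * (a + b)
      ≡⟨ collect T fv (r ∸ b) (m ∸ a) a b ⟩
    T + fv * ((m ∸ a + a) + (r ∸ b + b))
      ≡⟨ cong₂ (λ x y → T + fv * (x + y)) (m∸n+n≡m a≤m) (m∸n+n≡m b≤r) ⟩
    T + fv * (m + r)
      ≡⟨ cong (λ x → T + fv * x) (m+[n∸m]≡n (m/n≤m n 2)) ⟩
    T + fv * n ∎
    where
    T : ℕ
    T = triangles P + triangles Q + tau P Q R
    collect : ∀ T f s q a b → T + f * s + f * q + f * (a + b) ≡ T + f * ((q + a) + (s + b))
    collect = ℕ-Solver.solve-∀

lemma2p3 : (k t : ℕ) → 3 ≤ k → 1 ≤ t → (fv : ℕ) → IsF (k ∸ 1) (k ∸ 1) fv →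
    ((a b : ℕ) (P : Graph a) (Q : Graph b) (R : BipGraph a b) →
      Admissible k fv P Q R →
      ∃ (λ N → (n : ℕ) → N ≤ n →
        + value t (H n P Q R)
          ≡ + (t * ((n * n) / 4)) +ℤ + (fv * n) +ℤ Φ fv P Q R t))
    × ((c : ℤ) → IsCStar k fv t c →
      ∃ (λ N → (n : ℕ) → N ≤ n →
        Σ (Graph n) (λ G → FkFree k G ×
          (+ (t * ((n * n) / 4)) +ℤ + (fv * n) +ℤ c ≤ℤ + value t G))))
lemma2p3 k t 3≤k _ fv _ =
  (λ a b P Q R adm → 2 * (a + b) , λ n → value-H t fv n P Q R (edges-P adm) (edges-Q adm)) ,
  λ { c ((a , b , P , Q , R , adm , Φ≡c) , _) → 2 * (a + b) , λ n 2[a+b]≤n →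
        H n P Q R ,
        H-FkFree n P Q R (≤-trans (s≤s z≤n) 3≤k) adm ,
        ≤ℤ-reflexive (trans (cong (+ (t * ((n * n) / 4)) +ℤ + (fv * n) +ℤ_) (sym Φ≡c))
                            (sym (value-H t fv n P Q R (edges-P adm) (edges-Q adm) 2[a+b]≤n))) }
  where
  edges-P : ∀ {a b} {P : Graph a} {Q : Graph b} {R} → Admissible k fv P Q R → edges P ≡ fv
  edges-P ((_ , _ , _ , e[P]≡fv) , _) = e[P]≡fv
  edges-Q : ∀ {a b} {P : Graph a} {Q : Graph b} {R} → Admissible k fv P Q R → edges Q ≡ fv
  edges-Q (_ , (_ , _ , _ , e[Q]≡fv) , _) = e[Q]≡fv
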